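{- Let $a\ge 2$ be an integer, let $H$ be a finite simple graph and let $S_1,S_2,\dots,S_{a-1}$ be a partition of $V(H)$ (parts possibly empty) such that $d_H(x)\leq j$ for every $x\in S_j$, $1\le j\le a-1$. Then there exist a maximal independent set $I$ and a covering set $C$ of $H$ with $I\cap C=\emptyset$ such that $$\sum_{j=1}^{a-1}(a-j)c_j\leq \sum_{j=1}^{a-1}j(a-j)i_j,$$ where $c_j=|S_j\cap C|$ and $i_j=|S_j\cap I|$.
   Context: A set $I\subseteq V(H)$ is independent if no two of its vertices are adjacent; a set $C\subseteq V(H)$ is a covering set if every edge of $H$ has an endpoint in $C$. -}

module Defs where

open import Data.Nat using (ℕ; zero; suc; _+_; _*_; _∸_; _≤_)
open import Data.Fin using (Fin; toℕ)
open import Data.Bool using (Bool; true; false; if_then_else_; _∧_)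
open import Data.Product using (_×_; Σ; _,_)
open import Data.Empty using (⊥)
open import Relation.Nullary using (¬_)
open import Relation.Binary.PropositionalEquality using (_≡_; _≢_)

count : ∀ {n} → (Fin n → Bool) → ℕ
count {zero}  p = 0
count {suc n} p = (if p Fin.zero then 1 else 0) + count (λ i → p (Fin.suc i))

sumFrom1 : ℕ → (ℕ → ℕ) → ℕ
sumFrom1 zero    f = 0
sumFrom1 (suc m) f = sumFrom1 m f + f (suc m)

record SimpleGraph (n : ℕ) : Set where
  field
    adj   : Fin n → Fin n → Bool
    sym   : ∀ x y → adj x y ≡ adj y x
    irrefl : ∀ x → adj x x ≡ false

open SimpleGraph public

VSet : ℕ → Set
VSet n = Fin n → Bool

degree : ∀ {n} → SimpleGraph n → Fin n → ℕ
degree H x = count (λ y → adj H x y)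

Independent : ∀ {n} → SimpleGraph n → VSet n → Set
Independent H I = ∀ x y → I x ≡ true → I y ≡ true → adj H x y ≡ false

_⊆_ : ∀ {n} → VSet n → VSet n → Set
A ⊆ B = ∀ x → A x ≡ true → B x ≡ true

MaximalIndependent : ∀ {n} → SimpleGraph n → VSet n → Set
MaximalIndependent {n} H I =
  Independent H I ×
  (∀ (J : VSet n) → Independent H J → I ⊆ J → J ⊆ I)

Covering : ∀ {n} → SimpleGraph n → VSet n → Set
Covering H C = ∀ x y → adj H x y ≡ true → (C x ≡ true) Data.Sum.⊎ (C y ≡ true)
  where import Data.Sum

Disjoint : ∀ {n} → VSet n → VSet n → Set
Disjoint I C = ∀ x → I x ≡ true → C x ≡ false

-- |S_j ∩ A| where the partition is given by a labelling part : Fin n → ℕ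
-- (vertex x lies in S_{part x}).
partCount : ∀ {n} → (Fin n → ℕ) → ℕ → VSet n → ℕ
partCount part j A = count (λ x → (part x Data.Nat.≡ᵇ j) ∧ A x)
  where import Data.Nat

-- Build I greedily, scanning the vertices by increasing part index (ties broken
-- by vertex number), and let C be its complement. Every x ∈ C then has a
-- neighbour y ∈ I with part y ≤ part x, hence with a weight a − part y at least
-- a − part x. Charging each x ∈ C to such a y and double counting the edges,
-- y is charged at most d(y) ≤ part y times, each time at most a − part y.
module Submission where

open import Defs renaming (sym to adj-sym)
open import Data.Nat using (ℕ; _+_; _*_; _∸_; _≤_)
open import Data.Fin using (Fin)
open import Data.Product using (Σ; _×_)

open import Data.Nat using (zero; suc; _<_; _≡ᵇ_; z≤n; s≤s)
open import Data.Nat.Properties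
open import Data.Fin using (zero; suc; toℕ)
open import Data.Fin.Properties using (toℕ<n; toℕ-injective; any?)
open import Data.Bool using (Bool; true; false; _∧_; not; if_then_else_)
import Data.Bool.Properties as Bool
open import Data.Product using (_,_; ∃-syntax)
open import Data.Sum using (inj₁; inj₂)
open import Function using (_∘_; Injective)
open import Relation.Nullary using (Dec; yes; no; does; contradiction; _×-dec_)
open import Relation.Nullary.Decidable using (dec-true; dec-false)
open import Relation.Binary using (tri<; tri≈; tri>)
open import Relation.Binary.PropositionalEquality
open import Algebra.Properties.CommutativeMonoid.Sum +-0-commutativeMonoid
  using (sum; sum-cong-≗; sum-replicate-zero; ∑-distrib-+; ∑-comm)

sum-mono-≤ : ∀ {n} {f g : Fin n → ℕ} → (∀ x → f x ≤ g x) → sum f ≤ sum g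
sum-mono-≤ {zero}  f≤g = z≤n
sum-mono-≤ {suc n} f≤g = +-mono-≤ (f≤g zero) (sum-mono-≤ (f≤g ∘ suc))

≤-sum : ∀ {n} (f : Fin n → ℕ) x → f x ≤ sum f
≤-sum f zero    = m≤m+n _ _
≤-sum f (suc x) = ≤-trans (≤-sum (f ∘ suc) x) (m≤n+m _ (f zero))

sum-if≡count* : ∀ {n} (p : Fin n → Bool) c →
  sum (λ x → if p x then c else 0) ≡ count p * c
sum-if≡count* {zero}  p c = refl
sum-if≡count* {suc n} p c with p zero
... | true  = cong (c +_) (sum-if≡count* (p ∘ suc) c)
... | false = sum-if≡count* (p ∘ suc) c

sumOn : ∀ {n} → VSet n → (Fin n → ℕ) → ℕ
sumOn A w = sum (λ x → if A x then w x else 0)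

sumOn-mono-≤ : ∀ {n} (A : VSet n) {v w : Fin n → ℕ} → (∀ x → v x ≤ w x) →
  sumOn A v ≤ sumOn A w
sumOn-mono-≤ A v≤w = sum-mono-≤ λ x → v≤w-on x (A x)
  where
  v≤w-on : ∀ x b → (if b then _ else 0) ≤ (if b then _ else 0)
  v≤w-on x true  = v≤w x
  v≤w-on x false = z≤n

sumFrom1-cong : ∀ m {f g : ℕ → ℕ} → (∀ j → f j ≡ g j) → sumFrom1 m f ≡ sumFrom1 m g
sumFrom1-cong zero    f≡g = refl
sumFrom1-cong (suc m) f≡g = cong₂ _+_ (sumFrom1-cong m f≡g) (f≡g (suc m))

sumFrom1-vanishes : ∀ m {f : ℕ → ℕ} → (∀ j → j ≤ m → f j ≡ 0) → sumFrom1 m f ≡ 0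
sumFrom1-vanishes zero    f≡0 = refl
sumFrom1-vanishes (suc m) f≡0 =
  cong₂ _+_ (sumFrom1-vanishes m λ j j≤m → f≡0 j (m≤n⇒m≤1+n j≤m)) (f≡0 (suc m) ≤-refl)

sumFrom1-∑-comm : ∀ {n} m (h : ℕ → Fin n → ℕ) →
  sumFrom1 m (λ j → sum (h j)) ≡ sum (λ x → sumFrom1 m (λ j → h j x))
sumFrom1-∑-comm {n} zero h = sym (sum-replicate-zero n)
sumFrom1-∑-comm (suc m) h =
  trans (cong (_+ sum (h (suc m))) (sumFrom1-∑-comm m h)) (sym (∑-distrib-+ _ (h (suc m))))

if-≡ᵇ-≢ : ∀ {p j} x → p ≢ j → (if p ≡ᵇ j then x else 0) ≡ 0
if-≡ᵇ-≢ {p} {j} x p≢j = cong (λ b → if b then x else 0) (dec-false (p ≟ j) p≢j)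

sumFrom1-single : ∀ m {p} (c : ℕ → ℕ) → 1 ≤ p → p ≤ m →
  sumFrom1 m (λ j → if p ≡ᵇ j then c j else 0) ≡ c p
sumFrom1-single zero    {suc _} c 1≤p ()
sumFrom1-single (suc m) {p}     c 1≤p p≤1+m with p ≟ suc m
... | yes refl = cong₂ _+_ (sumFrom1-vanishes m λ j j≤m → if-≡ᵇ-≢ (c j) (>⇒≢ (s≤s j≤m)))
                           (cong (λ b → if b then c (suc m) else 0) (dec-true (suc m ≟ suc m) refl))
... | no p≢1+m = trans (cong₂ _+_ (sumFrom1-single m c 1≤p (≤-pred (≤∧≢⇒< p≤1+m p≢1+m)))
                                  (if-≡ᵇ-≢ (c (suc m)) p≢1+m))
                       (+-identityʳ (c p))

sumFrom1-select : ∀ m {p} b (c : ℕ → ℕ) → 1 ≤ p → p ≤ m →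
  sumFrom1 m (λ j → if (p ≡ᵇ j) ∧ b then c j else 0) ≡ (if b then c p else 0)
sumFrom1-select m {p} false c _ _ =
  sumFrom1-vanishes m λ j _ → cong (λ b → if b then c j else 0) (Bool.∧-zeroʳ (p ≡ᵇ j))
sumFrom1-select m {p} true c 1≤p p≤m =
  trans (sumFrom1-cong m λ j → cong (λ b → if b then c j else 0) (Bool.∧-identityʳ (p ≡ᵇ j)))
        (sumFrom1-single m c 1≤p p≤m)

sumFrom1-partCount : ∀ {n} m (part : Fin n → ℕ) → (∀ x → 1 ≤ part x) → (∀ x → part x ≤ m) →
  (g : ℕ → ℕ) (A : VSet n) → sumFrom1 m (λ j → g j * partCount part j A) ≡ sumOn A (g ∘ part)
sumFrom1-partCount m part 1≤part part≤m g A = begin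
  sumFrom1 m (λ j → g j * partCount part j A)
    ≡⟨ sumFrom1-cong m (λ j → trans (*-comm (g j) _)
                                     (sym (sum-if≡count* (λ x → (part x ≡ᵇ j) ∧ A x) (g j)))) ⟩
  sumFrom1 m (λ j → sum (λ x → if (part x ≡ᵇ j) ∧ A x then g j else 0))
    ≡⟨ sumFrom1-∑-comm m (λ j x → if (part x ≡ᵇ j) ∧ A x then g j else 0) ⟩
  sum (λ x → sumFrom1 m (λ j → if (part x ≡ᵇ j) ∧ A x then g j else 0))
    ≡⟨ sum-cong-≗ (λ x → sumFrom1-select m (A x) g (1≤part x) (part≤m x)) ⟩
  sumOn A (g ∘ part)
    ∎
  where open ≡-Reasoning

Dominating : ∀ {n} → SimpleGraph n → (Fin n → Fin n → Set) → VSet n → Set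
Dominating H _≼_ I = ∀ x → I x ≡ false → ∃[ y ] adj H x y ≡ true × I y ≡ true × y ≼ x

Dominating-map : ∀ {n} (H : SimpleGraph n) {_≼_ _⊑_ : Fin n → Fin n → Set} {I} →
  (∀ {y x} → y ≼ x → y ⊑ x) → Dominating H _≼_ I → Dominating H _⊑_ I
Dominating-map H ≼⇒⊑ dom x Ix with dom x Ix
... | y , xy , Iy , y≼x = y , xy , Iy , ≼⇒⊑ y≼x

independent∧dominating⇒maximal : ∀ {n} (H : SimpleGraph n) {_≼_} {I} →
  Independent H I → Dominating H _≼_ I → MaximalIndependent H I
independent∧dominating⇒maximal H {I = I} indep dom = indep , maximal
  where
  maximal : ∀ J → Independent H J → I ⊆ J → J ⊆ I
  maximal J indepJ I⊆J x Jx with I x in Ix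
  ... | true  = refl
  ... | false with dom x Ix
  ... | y , xy , Iy , _ = contradiction (trans (sym xy) (indepJ x y Jx (I⊆J y Iy))) λ ()

independent⇒complement-covering : ∀ {n} (H : SimpleGraph n) {I} →
  Independent H I → Covering H (not ∘ I)
independent⇒complement-covering H {I} indep x y xy with I x in Ix | I y in Iy
... | false | _     = inj₁ refl
... | true  | false = inj₂ refl
... | true  | true  = contradiction (trans (sym xy) (indep x y Ix Iy)) λ ()

complement-disjoint : ∀ {n} (I : VSet n) → Disjoint I (not ∘ I)
complement-disjoint I x Ix = cong not Ix

sumOn-complement≤ : ∀ {n} (H : SimpleGraph n) (I : VSet n) (w : Fin n → ℕ) →
  Dominating H (λ y x → w x ≤ w y) I →
  sumOn (not ∘ I) w ≤ sumOn I (λ y → degree H y * w y)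
sumOn-complement≤ {n} H I w dom = begin
  sumOn (not ∘ I) w                     ≤⟨ sum-mono-≤ outside≤charges ⟩
  sum (λ x → sum (λ y → charge x y))    ≡⟨ ∑-comm charge ⟩
  sum (λ y → sum (λ x → charge x y))    ≡⟨ sum-cong-≗ (λ y → charges-received y (I y)) ⟩
  sumOn I (λ y → degree H y * w y)      ∎
  where
  open ≤-Reasoning

  charge : Fin n → Fin n → ℕ
  charge x y = if I y ∧ adj H x y then w y else 0

  outside≤charges : ∀ x → (if not (I x) then w x else 0) ≤ sum (charge x)
  outside≤charges x with I x in Ix
  ... | true  = z≤n
  ... | false with dom x Ix
  ... | y , xy , Iy , wx≤wy = ≤-trans wx≤wy (≤-trans (≤-reflexive charge≡w) (≤-sum (charge x) y))
    where
    charge≡w : w y ≡ charge x y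
    charge≡w = cong (λ b → if b then w y else 0) (sym (cong₂ _∧_ Iy xy))

  charges-received : ∀ y b → sum (λ x → if b ∧ adj H x y then w y else 0)
                              ≡ (if b then degree H y * w y else 0)
  charges-received y false = sum-replicate-zero n
  charges-received y true  = begin-equality
    sum (λ x → if adj H x y then w y else 0)
      ≡⟨ sum-cong-≗ (λ x → cong (λ b → if b then w y else 0) (adj-sym H x y)) ⟩
    sum (λ x → if adj H y x then w y else 0)
      ≡⟨ sum-if≡count* (adj H y) (w y) ⟩
    degree H y * w y
      ∎

module Greedy {n} (H : SimpleGraph n) (key : Fin n → ℕ) where

  HasNeighbourIn : VSet n → Fin n → Set
  HasNeighbourIn A x = ∃[ y ] adj H x y ≡ true × A y ≡ true

  hasNeighbourIn? : ∀ A x → Dec (HasNeighbourIn A x)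
  hasNeighbourIn? A x = any? λ y → (adj H x y Bool.≟ true) ×-dec (A y Bool.≟ true)

  greedy : ℕ → VSet n
  greedy zero    x = false
  greedy (suc k) x with key x ≟ k
  ... | yes _ = not (does (hasNeighbourIn? (greedy k) x))
  ... | no  _ = greedy k x

  greedy⇒key< : ∀ k {x} → greedy k x ≡ true → key x < k
  greedy⇒key< (suc k) {x} gx with key x ≟ k
  ... | yes refl = n<1+n (key x)
  ... | no  _    = m<n⇒m<1+n (greedy⇒key< k gx)

  greedy-at-key : ∀ x → greedy (suc (key x)) x ≡ not (does (hasNeighbourIn? (greedy (key x)) x))
  greedy-at-key x with key x ≟ key x
  ... | yes _ = refl
  ... | no  ≢ = contradiction refl ≢

  greedy-settled : ∀ {k} x → key x < k → greedy k x ≡ greedy (suc (key x)) x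
  greedy-settled {suc k} x x<1+k with key x ≟ k
  ... | yes refl = sym (greedy-at-key x)
  ... | no  x≢k  = greedy-settled x (≤∧≢⇒< (≤-pred x<1+k) x≢k)

  I : VSet n
  I = greedy (suc (sum key))

  greedy≡I : ∀ {k} x → key x < k → greedy k x ≡ I x
  greedy≡I x x<k = trans (greedy-settled x x<k) (sym (greedy-settled x (s≤s (≤-sum key x))))

  I≡no-earlier-neighbour : ∀ x → I x ≡ not (does (hasNeighbourIn? (greedy (key x)) x))
  I≡no-earlier-neighbour x = trans (sym (greedy≡I x (n<1+n (key x)))) (greedy-at-key x)

  earlier-neighbour⇒∉I : ∀ {x y} → adj H x y ≡ true → key y < key x → I y ≡ true → I x ≡ false
  earlier-neighbour⇒∉I {x} {y} xy y<x Iy =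
    trans (I≡no-earlier-neighbour x)
          (cong not (dec-true (hasNeighbourIn? _ x) (y , xy , trans (greedy≡I y y<x) Iy)))

  I-dominating : Dominating H (λ y x → key y < key x) I
  I-dominating x Ix with hasNeighbourIn? (greedy (key x)) x | I≡no-earlier-neighbour x
  ... | yes (y , xy , gy) | _  =
    y , xy , trans (sym (greedy≡I y (greedy⇒key< (key x) gy))) gy , greedy⇒key< (key x) gy
  ... | no  _           | Ix≡true = contradiction (trans (sym Ix) Ix≡true) λ ()

  I-independent : Injective _≡_ _≡_ key → Independent H I
  I-independent key-injective x y Ix Iy with adj H x y in xy | <-cmp (key x) (key y)
  ... | false | _           = refl
  ... | true  | tri< x<y _ _ =
    contradiction (trans (sym Iy) (earlier-neighbour⇒∉I (trans (adj-sym H y x) xy) x<y Ix)) λ ()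
  ... | true  | tri> _ _ y<x =
    contradiction (trans (sym Ix) (earlier-neighbour⇒∉I xy y<x Iy)) λ ()
  ... | true  | tri≈ _ x≡y _ =
    contradiction (trans (sym (irrefl H x)) (subst (λ z → adj H x z ≡ true) (sym (key-injective x≡y)) xy))
                  λ ()

lexKey : ∀ {n} → (Fin n → ℕ) → Fin n → ℕ
lexKey {n} f x = f x * n + toℕ x

lexKey-mono-< : ∀ {n} (f : Fin n → ℕ) {x y} → f x < f y → lexKey f x < lexKey f y
lexKey-mono-< {n} f {x} {y} fx<fy = begin-strict
  f x * n + toℕ x   <⟨ +-monoʳ-< (f x * n) (toℕ<n x) ⟩
  f x * n + n       ≡⟨ +-comm (f x * n) n ⟩
  suc (f x) * n     ≤⟨ *-monoˡ-≤ n fx<fy ⟩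
  f y * n           ≤⟨ m≤m+n _ _ ⟩
  f y * n + toℕ y   ∎
  where open ≤-Reasoning

lexKey<⇒≤ : ∀ {n} (f : Fin n → ℕ) {x y} → lexKey f x < lexKey f y → f x ≤ f y
lexKey<⇒≤ f {x} {y} kx<ky = ≮⇒≥ λ fy<fx → <-asym kx<ky (lexKey-mono-< f fy<fx)

lexKey-injective : ∀ {n} (f : Fin n → ℕ) → Injective _≡_ _≡_ (lexKey f)
lexKey-injective {n} f {x} {y} kx≡ky with <-cmp (f x) (f y)
... | tri< fx<fy _ _ = contradiction kx≡ky (<⇒≢ (lexKey-mono-< f fx<fy))
... | tri> _ _ fy<fx = contradiction kx≡ky (>⇒≢ (lexKey-mono-< f fy<fx))
... | tri≈ _ fx≡fy _ =
  toℕ-injective (+-cancelˡ-≡ (f x * n) _ _ (trans kx≡ky (cong (λ t → t * n + toℕ y) (sym fx≡fy))))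

corollary1 : (a : ℕ) → 2 ≤ a → (n : ℕ) → (H : SimpleGraph n) →
    (part : Fin n → ℕ) →
    (∀ x → 1 ≤ part x) → (∀ x → part x ≤ a ∸ 1) →
    (∀ x → degree H x ≤ part x) →
    Σ (VSet n) λ I → Σ (VSet n) λ C →
      MaximalIndependent H I × Covering H C × Disjoint I C ×
      (sumFrom1 (a ∸ 1) (λ j → (a ∸ j) * partCount part j C)
        ≤ sumFrom1 (a ∸ 1) (λ j → j * (a ∸ j) * partCount part j I))
corollary1 a _ n H part 1≤part part≤a∸1 degree≤part =
  I , not ∘ I ,
  independent∧dominating⇒maximal H independent I-dominating ,
  independent⇒complement-covering H independent , complement-disjoint I , weights
  where
  open Greedy H (lexKey part)
  open ≤-Reasoning

  independent : Independent H I
  independent = I-independent (lexKey-injective part)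

  dominated-by-heavier : Dominating H (λ y x → a ∸ part x ≤ a ∸ part y) I
  dominated-by-heavier =
    Dominating-map H (λ y<x → ∸-monoʳ-≤ a (lexKey<⇒≤ part y<x)) I-dominating

  partSum : (g : ℕ → ℕ) (A : VSet n) →
    sumFrom1 (a ∸ 1) (λ j → g j * partCount part j A) ≡ sumOn A (g ∘ part)
  partSum = sumFrom1-partCount (a ∸ 1) part 1≤part part≤a∸1

  weights : sumFrom1 (a ∸ 1) (λ j → (a ∸ j) * partCount part j (not ∘ I))
          ≤ sumFrom1 (a ∸ 1) (λ j → j * (a ∸ j) * partCount part j I)
  weights = begin
    sumFrom1 (a ∸ 1) (λ j → (a ∸ j) * partCount part j (not ∘ I))
      ≡⟨ partSum (a ∸_) (not ∘ I) ⟩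
    sumOn (not ∘ I) (λ x → a ∸ part x)
      ≤⟨ sumOn-complement≤ H I (λ x → a ∸ part x) dominated-by-heavier ⟩
    sumOn I (λ y → degree H y * (a ∸ part y))
      ≤⟨ sumOn-mono-≤ I (λ y → *-monoˡ-≤ (a ∸ part y) (degree≤part y)) ⟩
    sumOn I (λ y → part y * (a ∸ part y))
      ≡⟨ partSum (λ j → j * (a ∸ j)) I ⟨
    sumFrom1 (a ∸ 1) (λ j → j * (a ∸ j) * partCount part j I)
      ∎
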